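{- Let $m\ge 1$ and $n\ge 1$ be integers, and let $G=(V,E)$ be either the Kautz graph $\mathrm{Kautz}_{n+1}(m)$ or the de Bruijn graph $DB_{n+1}(m)$. Then $G$ contains a directed cycle $(v_1,v_2,\ldots,v_c)$ of distinct vertices, of length $c=|V|/m$, which contains exactly one vertex from each similarity class of vertices.
   Context: A Kautz string is a string with no two adjacent characters equal. $\mathrm{Kautz}_k(m)$ has as vertices the Kautz strings of length $k$ over $m+1$ symbols and as edges the Kautz strings $s_0\ldots s_k$ of length $k+1$, directed from $s_0\ldots s_{k-1}$ to $s_1\ldots s_k$. $DB_k(m)$ has as vertices all strings of length $k$ over $m$ symbols and as edges all strings $s_0\ldots s_k$ of length $k+1$, directed from $s_0\ldots s_{k-1}$ to $s_1\ldots s_k$. Two vertex strings of the same length are similar if they agree after deleting their first character; similarity classes each contain $m$ vertices. A directed cycle $(v_1,\ldots,v_c)$ means $(v_i,v_{i+1})$ is an edge for $1\le i<c$ and $(v_c,v_1)$ is an edge. -}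

module Defs where

open import Data.Nat using (ℕ; zero; suc; _*_; _≤_)
open import Data.Fin using (Fin; zero; suc; inject₁; fromℕ; _≟_)
open import Data.Fin.Properties using () renaming (_≟_ to _≟F_)
open import Data.Vec using (Vec; []; _∷_; init; tail)
open import Data.List using (List; []; _∷_; map; concatMap; filter; length; allFin)
open import Data.Product using (Σ; _×_; _,_; ∃)
open import Data.Unit using (⊤; tt)
open import Relation.Nullary using (¬_; Dec; yes; no)
open import Relation.Binary.PropositionalEquality using (_≡_)

Str : ℕ → ℕ → Set
Str s k = Vec (Fin s) k

data KautzStr {s : ℕ} : {k : ℕ} → Str s k → Set where
  kz-nil  : KautzStr []
  kz-one  : (x : Fin s) → KautzStr (x ∷ [])
  kz-cons : ∀ {k} (x y : Fin s) (w : Str s k) →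
            ¬ (x ≡ y) → KautzStr (y ∷ w) → KautzStr (x ∷ y ∷ w)

kautz? : ∀ {s k} (w : Str s k) → Dec (KautzStr w)
kautz? [] = yes kz-nil
kautz? (x ∷ []) = yes (kz-one x)
kautz? (x ∷ y ∷ w) with x ≟F y | kautz? (y ∷ w)
... | yes x≡y | _ = no λ { (kz-cons _ _ _ x≢y _) → x≢y x≡y }
... | no x≢y | yes k = yes (kz-cons x y w x≢y k)
... | no _ | no ¬k = no λ { (kz-cons _ _ _ _ k) → ¬k k }

data Kind : Set where
  kautz    : Kind   -- Kautz_k(m): Kautz strings over m+1 symbols
  deBruijn : Kind   -- DB_k(m): all strings over m symbols

alphabet : Kind → ℕ → ℕ
alphabet kautz    m = suc m
alphabet deBruijn m = m

-- Which strings are admissible (as vertices, length k, or edges, length k+1).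
Valid : (K : Kind) (m : ℕ) {k : ℕ} → Str (alphabet K m) k → Set
Valid kautz    m w = KautzStr w
Valid deBruijn m w = ⊤

valid? : (K : Kind) (m : ℕ) {k : ℕ} (w : Str (alphabet K m) k) → Dec (Valid K m w)
valid? kautz    m w = kautz? w
valid? deBruijn m w = yes tt

IsVertex : (K : Kind) (m k : ℕ) → Str (alphabet K m) k → Set
IsVertex K m k v = Valid K m v

Edge : (K : Kind) (m k : ℕ) → Str (alphabet K m) k → Str (alphabet K m) k → Set
Edge K m k u v = Σ (Str (alphabet K m) (suc k)) λ w →
  Valid K m w × init w ≡ u × tail w ≡ v

allStr : (s k : ℕ) → List (Str s k)
allStr s zero    = [] ∷ []
allStr s (suc k) = concatMap (λ x → map (x ∷_) (allStr s k)) (allFin s)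

numVertices : (K : Kind) (m k : ℕ) → ℕ
numVertices K m k = length (filter (valid? K m) (allStr (alphabet K m) k))

Similar : ∀ {s k} → Str s (suc k) → Str s (suc k) → Set
Similar u v = tail u ≡ tail v

-- A directed cycle (v_1,…,v_c) of distinct vertices, c = suc c', given as
-- a map Fin c → strings, with edges (v_i, v_{i+1}) and (v_c, v_1).
record DirectedCycle (K : Kind) (m k c' : ℕ) : Set where
  field
    vtx      : Fin (suc c') → Str (alphabet K m) k
    isVertex : ∀ i → IsVertex K m k (vtx i)
    distinct : ∀ i j → vtx i ≡ vtx j → i ≡ j
    step     : ∀ (i : Fin c') → Edge K m k (vtx (inject₁ i)) (vtx (suc i))
    close    : Edge K m k (vtx (fromℕ c')) (vtx zero)

module Submission where

-- An edge u → v of G_n is a valid string W of length n+1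
-- with init W = u and tail W = v, i.e. a vertex of G_{n+1}; two such
-- strings W, W' are adjacent in G_{n+1} exactly when tail W = init W'.
-- Hence the edges of a Hamiltonian cycle (h_1,…,h_c) of G_n form a cycle
-- of G_{n+1} whose vertices have the pairwise distinct tails h_1,…,h_c.
-- Since similarity means "equal tail" and every tail is a vertex of G_n,
-- this cycle meets every similarity class exactly once, and its length is
-- c = |V(G_n)| = |V(G_{n+1})|/m (double counting, `numVertices-step`).
--
-- Hamiltonicity of G_n is proved by cycle joining (module CycleJoining,
-- for an abstract finite graph).  A permutation σ with edges v → σ v
-- splits the vertices into disjoint σ-orbits.  Vertices with the same key
-- (here: the same tail) have the same out-neighbours, so a cycle through u
-- and a disjoint orbit through a vertex u' with the key of u splice into
-- one cycle.  Joining until no such u' exists leaves a cycle closed under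
-- out-edges, which covers everything because the graph is strongly
-- connected.  The hypotheses are verified for DB_k(m) and Kautz_k(m)
-- with k ≥ 2; Kautz_1(m) is a complete graph with an explicit cycle.

open import Defs
open import Data.Nat using (ℕ; zero; suc; _+_; _*_; _≤_; _<_; z≤n; s≤s)
open import Data.Nat.Properties
open import Data.Nat.Tactic.RingSolver using (solve-∀)
open import Data.Bool using (Bool; true; false; _∧_)
open import Data.Empty using (⊥; ⊥-elim)
open import Data.Unit using (tt)
open import Data.Sum using (_⊎_; inj₁; inj₂)
open import Data.Product using (Σ; _×_; _,_; proj₁; proj₂)
open import Data.Fin using (Fin; zero; suc; inject₁; fromℕ)
open import Data.Fin.Properties using () renaming (_≟_ to _≟F_; suc-injective to Fin-suc-injective)
open import Data.Vec using (Vec; []; _∷_; _∷ʳ_; head; last; tail; init; toList; initLast; replicate)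
open import Data.Vec.Properties using (≡-dec; init-∷ʳ; last-∷ʳ; ∷ʳ-injective; toList-∷ʳ; toList-injective; ∷-injectiveˡ)
open import Data.Vec.Relation.Binary.Equality.Cast using (cast-is-id)
open import Data.List using (List; []; _∷_; _++_; map; concatMap; filter; length; allFin; lookup; [_]; drop)
open import Data.List.Properties using (++-assoc; ++-identityʳ; length-map; length-tabulate; map-tabulate)
open import Data.List.Relation.Unary.Any using (Any; here; there; any?; index)
open import Data.List.Relation.Unary.Any.Properties using (lookup-index)
open import Data.List.Relation.Unary.All.Properties using (All¬⇒¬Any)
open import Data.List.Relation.Unary.Unique.Propositional using (Unique; []; _∷_)
open import Data.List.Relation.Unary.Unique.Propositional.Properties using (allFin⁺)
open import Data.List.Membership.Propositional using (_∈_; _∉_; lose)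
open import Data.List.Membership.Propositional.Properties
  using (∈-concatMap⁺; ∈-allFin; ∈-++⁺ˡ; ∈-++⁺ʳ; ∈-++⁻; ∈-∃++; ∈-map⁺; ∈-map⁻; ∈-filter⁺; ∈-filter⁻; ∈-lookup)
import Data.List.Membership.DecPropositional as DecMembership
open import Relation.Nullary using (¬_; Dec; yes; no; does)
open import Relation.Nullary.Decidable using (¬?; _×-dec_)
open import Relation.Binary using (DecidableEquality)
open import Relation.Binary.PropositionalEquality hiding ([_])

module _ {A : Set} where
  sumL : (A → ℕ) → List A → ℕ
  sumL f [] = 0
  sumL f (x ∷ xs) = f x + sumL f xs

  sumL-++ : ∀ f xs ys → sumL f (xs ++ ys) ≡ sumL f xs + sumL f ys
  sumL-++ f [] ys = refl
  sumL-++ f (x ∷ xs) ys = trans (cong (f x +_) (sumL-++ f xs ys)) (sym (+-assoc (f x) _ _))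

  sumL-cong : ∀ {f g} xs → (∀ {x} → x ∈ xs → f x ≡ g x) → sumL f xs ≡ sumL g xs
  sumL-cong [] h = refl
  sumL-cong (x ∷ xs) h = cong₂ _+_ (h (here refl)) (sumL-cong xs (λ m → h (there m)))

  sumL-+ : ∀ f g xs → sumL (λ x → f x + g x) xs ≡ sumL f xs + sumL g xs
  sumL-+ f g [] = refl
  sumL-+ f g (x ∷ xs) rewrite sumL-+ f g xs = interchange (f x) (g x) (sumL f xs) (sumL g xs)
    where
    interchange : ∀ a b c d → a + b + (c + d) ≡ a + c + (b + d)
    interchange = solve-∀

  sumL-*ˡ : ∀ k f xs → sumL (λ x → k * f x) xs ≡ k * sumL f xs
  sumL-*ˡ k f [] = sym (*-zeroʳ k)
  sumL-*ˡ k f (x ∷ xs) rewrite sumL-*ˡ k f xs = sym (*-distribˡ-+ k (f x) _)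

  sumL-0 : ∀ xs → sumL (λ _ → 0) xs ≡ 0
  sumL-0 [] = refl
  sumL-0 (x ∷ xs) = sumL-0 xs

  sumL-1 : ∀ xs → sumL (λ _ → 1) xs ≡ length xs
  sumL-1 [] = refl
  sumL-1 (x ∷ xs) = cong suc (sumL-1 xs)

  sumL-mono : ∀ {f g} xs → (∀ x → f x ≤ g x) → sumL f xs ≤ sumL g xs
  sumL-mono [] h = z≤n
  sumL-mono (x ∷ xs) h = +-mono-≤ (h x) (sumL-mono xs h)

  sumL-strict : ∀ {f g} {y} xs → (∀ x → f x ≤ g x) → y ∈ xs → f y < g y → sumL f xs < sumL g xs
  sumL-strict (x ∷ xs) h (here refl) lt = +-mono-<-≤ lt (sumL-mono xs h)
  sumL-strict (x ∷ xs) h (there m) lt = +-mono-≤-< (h x) (sumL-strict xs h m lt)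

  sumL-pos : ∀ {f} {y} xs → y ∈ xs → 1 ≤ f y → 1 ≤ sumL f xs
  sumL-pos {f} (x ∷ xs) (here refl) p = ≤-trans p (m≤m+n (f x) _)
  sumL-pos {f} (x ∷ xs) (there m) p = ≤-trans (sumL-pos xs m p) (m≤n+m _ (f x))

module _ {A B : Set} where
  sumL-map : ∀ (f : B → ℕ) (h : A → B) xs → sumL f (map h xs) ≡ sumL (λ x → f (h x)) xs
  sumL-map f h [] = refl
  sumL-map f h (x ∷ xs) = cong (f (h x) +_) (sumL-map f h xs)

  sumL-concatMap : ∀ (f : B → ℕ) (g : A → List B) xs →
                   sumL f (concatMap g xs) ≡ sumL (λ x → sumL f (g x)) xs
  sumL-concatMap f g [] = refl
  sumL-concatMap f g (x ∷ xs) =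
    trans (sumL-++ f (g x) (concatMap g xs)) (cong (sumL f (g x) +_) (sumL-concatMap f g xs))

  sumL-swap : ∀ (F : A → B → ℕ) xs ys →
              sumL (λ x → sumL (F x) ys) xs ≡ sumL (λ y → sumL (λ x → F x y) xs) ys
  sumL-swap F [] ys = sym (sumL-0 ys)
  sumL-swap F (x ∷ xs) ys =
    trans (cong (sumL (F x) ys +_) (sumL-swap F xs ys))
          (sym (sumL-+ (F x) (λ y → sumL (λ x → F x y) xs) ys))

bit : Bool → ℕ
bit true = 1
bit false = 0

bit-∧ : ∀ a b → bit (a ∧ b) ≡ bit a * bit b
bit-∧ true b = sym (+-identityʳ (bit b))
bit-∧ false b = refl

ind : ∀ {P : Set} → Dec P → ℕ
ind d = bit (does d)

ind-yes : ∀ {P : Set} (d : Dec P) → P → ind d ≡ 1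
ind-yes (yes _) p = refl
ind-yes (no np) p = ⊥-elim (np p)

ind-no : ∀ {P : Set} (d : Dec P) → ¬ P → ind d ≡ 0
ind-no (yes p) np = ⊥-elim (np p)
ind-no (no _) np = refl

ind≤1 : ∀ {P : Set} (d : Dec P) → ind d ≤ 1
ind≤1 (yes _) = s≤s z≤n
ind≤1 (no _) = z≤n

ind-¬ : ∀ {P : Set} (d : Dec P) → ind (¬? d) + ind d ≡ 1
ind-¬ (yes _) = refl
ind-¬ (no _) = refl

length-filter : ∀ {A : Set} {P : A → Set} (P? : (x : A) → Dec (P x)) L →
                length (filter P? L) ≡ sumL (λ x → ind (P? x)) L
length-filter P? [] = refl
length-filter P? (x ∷ L) with does (P? x)
... | true = cong suc (length-filter P? L)
... | false = length-filter P? L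

module Multiplicity {A : Set} (_≟_ : DecidableEquality A) where
  open DecMembership _≟_ using (_∈?_)

  mult : A → List A → ℕ
  mult x L = sumL (λ y → ind (x ≟ y)) L

  mult-++ : ∀ x xs ys → mult x (xs ++ ys) ≡ mult x xs + mult x ys
  mult-++ x xs ys = sumL-++ _ xs ys

  ≟-sym : ∀ x y → ind (x ≟ y) ≡ ind (y ≟ x)
  ≟-sym x y with x ≟ y | y ≟ x
  ... | yes _ | yes _ = refl
  ... | no _ | no _ = refl
  ... | yes e | no n = ⊥-elim (n (sym e))
  ... | no n | yes e = ⊥-elim (n (sym e))

  ∈⇒mult-pos : ∀ {x L} → x ∈ L → 1 ≤ mult x L
  ∈⇒mult-pos {x} {L} m = sumL-pos L m (≤-reflexive (sym (ind-yes (x ≟ x) refl)))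

  ∉⇒mult-zero : ∀ {x} L → x ∉ L → mult x L ≡ 0
  ∉⇒mult-zero [] n = refl
  ∉⇒mult-zero {x} (y ∷ L) n =
    cong₂ _+_ (ind-no (x ≟ y) (λ e → n (here e))) (∉⇒mult-zero L (λ m → n (there m)))

  mult-pos⇒∈ : ∀ {x} L → 1 ≤ mult x L → x ∈ L
  mult-pos⇒∈ {x} (y ∷ L) p with x ≟ y
  ... | yes e = here e
  ... | no _ = there (mult-pos⇒∈ L p)

  same-mult⇒⊆ : ∀ {L L'} → (∀ x → mult x L ≡ mult x L') → ∀ {x} → x ∈ L → x ∈ L'
  same-mult⇒⊆ {L' = L'} eq {x} m = mult-pos⇒∈ L' (subst (1 ≤_) (eq x) (∈⇒mult-pos m))

  Distinct : List A → Set
  Distinct L = ∀ x → mult x L ≤ 1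

  mult-distinct : ∀ {L x} → Distinct L → x ∈ L → mult x L ≡ 1
  mult-distinct {L} {x} d m = ≤-antisym (d x) (∈⇒mult-pos m)

  distinct-[_] : ∀ x → Distinct [ x ]
  distinct-[ x ] y = subst (_≤ 1) (sym (+-identityʳ _)) (ind≤1 (y ≟ x))

  distinct-tail : ∀ {y M} → Distinct (y ∷ M) → Distinct M
  distinct-tail {y} d x = ≤-trans (m≤n+m _ (ind (x ≟ y))) (d x)

  distinct-swap : ∀ xs ys → Distinct (xs ++ ys) → Distinct (ys ++ xs)
  distinct-swap xs ys d x
    rewrite mult-++ x ys xs | +-comm (mult x ys) (mult x xs) | sym (mult-++ x xs ys) = d x

  distinct-disjoint : ∀ xs ys → Distinct (xs ++ ys) → ∀ {x} → x ∈ xs → x ∈ ys → ⊥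
  distinct-disjoint xs ys d {x} m1 m2 with d x
  ... | le rewrite mult-++ x xs ys = <⇒≱ (+-mono-≤ (∈⇒mult-pos m1) (∈⇒mult-pos m2)) le

  distinct-++ : ∀ xs ys → Distinct xs → Distinct ys → (∀ {x} → x ∈ xs → x ∉ ys) → Distinct (xs ++ ys)
  distinct-++ xs ys dx dy disj x rewrite mult-++ x xs ys with x ∈? xs
  ... | yes m rewrite ∉⇒mult-zero ys (disj m) | +-identityʳ (mult x xs) = dx x
  ... | no n rewrite ∉⇒mult-zero xs n = dy x

  Unique⇒distinct : ∀ {L} → Unique L → Distinct L
  Unique⇒distinct [] x = z≤n
  Unique⇒distinct {y ∷ L} (y∉L ∷ u) x with x ≟ y
  ... | yes refl rewrite ∉⇒mult-zero {x} L (All¬⇒¬Any y∉L) = s≤s z≤n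
  ... | no _ = Unique⇒distinct u x

  distinct-filter : ∀ {P : A → Set} (P? : (x : A) → Dec (P x)) L → Distinct L → Distinct (filter P? L)
  distinct-filter P? L d x = ≤-trans (mult-filter L) (d x)
    where
    mult-filter : ∀ L → mult x (filter P? L) ≤ mult x L
    mult-filter [] = z≤n
    mult-filter (y ∷ L) with does (P? y)
    ... | true = +-monoʳ-≤ (ind (x ≟ y)) (mult-filter L)
    ... | false = ≤-trans (mult-filter L) (m≤n+m _ _)

  -- Distinct lists with the same members have the same length (double
  -- counting of the pairs (h, v) with h = v).
  distinct-length : ∀ {H Vs} → Distinct H → Distinct Vs →
                    (∀ {x} → x ∈ H → x ∈ Vs) → (∀ {x} → x ∈ Vs → x ∈ H) → length H ≡ length Vs
  distinct-length {H} {Vs} dH dV H⊆V V⊆H = begin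
      length H                                  ≡⟨ sym (sumL-1 H) ⟩
      sumL (λ _ → 1) H                          ≡⟨ sumL-cong H (λ m → sym (mult-distinct dV (H⊆V m))) ⟩
      sumL (λ h → mult h Vs) H                  ≡⟨ sumL-swap (λ h v → ind (h ≟ v)) H Vs ⟩
      sumL (λ v → sumL (λ h → ind (h ≟ v)) H) Vs ≡⟨ sumL-cong Vs (λ {v} _ → sumL-cong H (λ {h} _ → ≟-sym h v)) ⟩
      sumL (λ v → mult v H) Vs                  ≡⟨ sumL-cong Vs (λ m → mult-distinct dH (V⊆H m)) ⟩
      sumL (λ _ → 1) Vs                         ≡⟨ sumL-1 Vs ⟩
      length Vs                                 ∎
    where open ≡-Reasoning

  lookup-injective : ∀ {B : Set} (f : B → A) (L : List B) → Distinct (map f L) →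
                     ∀ i j → f (lookup L i) ≡ f (lookup L j) → i ≡ j
  lookup-injective f (x ∷ L) d zero zero e = refl
  lookup-injective f (x ∷ L) d zero (suc j) e =
    ⊥-elim (distinct-disjoint [ f x ] (map f L) d (here refl) (subst (_∈ map f L) (sym e) (∈-map⁺ f (∈-lookup j))))
  lookup-injective f (x ∷ L) d (suc i) zero e =
    ⊥-elim (distinct-disjoint [ f x ] (map f L) d (here refl) (subst (_∈ map f L) e (∈-map⁺ f (∈-lookup i))))
  lookup-injective f (x ∷ L) d (suc i) (suc j) e =
    cong suc (lookup-injective f L (distinct-tail {f x} {map f L} d) i j e)

-- Walks: `Walk R a L b` is a walk a → l₁ → … → l_k = b along R, recorded
-- by the list L = l₁ … l_k of vertices entered.  For a closed walk
-- (b = a) every visit of a vertex is listed exactly once.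

data Walk {A : Set} (R : A → A → Set) : A → List A → A → Set where
  [] : ∀ {a} → Walk R a [] a
  _∷_ : ∀ {a b c L} → R a b → Walk R b L c → Walk R a (b ∷ L) c

module _ {A : Set} {R : A → A → Set} where
  walk-++ : ∀ {a b c L M} → Walk R a L b → Walk R b M c → Walk R a (L ++ M) c
  walk-++ [] w = w
  walk-++ (e ∷ v) w = e ∷ walk-++ v w

  walk-snoc : ∀ {a b c L} → Walk R a L b → R b c → Walk R a (L ++ [ c ]) c
  walk-snoc w e = walk-++ w (e ∷ [])

  walk-split : ∀ {a c y ys} xs → Walk R a (xs ++ y ∷ ys) c → Walk R a (xs ++ [ y ]) y × Walk R y ys c
  walk-split [] (e ∷ w) = (e ∷ []) , w
  walk-split (x ∷ xs) (e ∷ w) = let p , q = walk-split xs w in (e ∷ p) , q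

  walk-end∈ : ∀ {a b L} → Walk R a L b → b ∈ a ∷ L
  walk-end∈ [] = here refl
  walk-end∈ (e ∷ w) = there (walk-end∈ w)

  module _ (_≟_ : DecidableEquality A) where
    open Multiplicity _≟_

    rotate : ∀ {z C u} → Walk R z C z → u ∈ C →
             Σ (List A) λ C' → Walk R u C' u × u ∈ C' × (∀ x → mult x C' ≡ mult x C)
    rotate {z} {C} {u} w m with ∈-∃++ m
    ... | xs , ys , refl with walk-split xs w
    ... | w1 , w2 = ys ++ (xs ++ [ u ]) , walk-++ w2 w1 , ∈-++⁺ʳ ys (∈-++⁺ʳ xs (here refl)) , same
      where
      rot3 : ∀ a b c → a + (b + c) ≡ b + (c + a)
      rot3 = solve-∀
      same : ∀ x → mult x (ys ++ (xs ++ [ u ])) ≡ mult x (xs ++ u ∷ ys)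
      same x rewrite mult-++ x ys (xs ++ [ u ]) | mult-++ x xs [ u ] | mult-++ x xs (u ∷ ys)
                   | +-identityʳ (ind (x ≟ u)) = rot3 (mult x ys) (mult x xs) (ind (x ≟ u))

record HamiltonianCycle {A : Set} (_≟_ : DecidableEquality A) (Vs : List A) (E : A → A → Set) : Set where
  open Multiplicity _≟_
  field
    H : List A
    z : A
    walk : Walk E z H z
    distinct : Distinct H
    ⊆Vs : ∀ {x} → x ∈ H → x ∈ Vs
    covers : ∀ {x} → x ∈ Vs → x ∈ H

-- Hypotheses:
--  * σ is a permutation of Vs (closed, injective) and v → σ v is an edge;
--  * a key (similarity class) such that vertices with equal keys have the
--    same out-neighbours (`transfer`) and all in-neighbours of a vertex
--    have equal keys (`in-similar`);
--  * strong connectivity, in the form: a set of vertices containing one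
--    vertex and closed under out-edges contains all of Vs.
-- Conclusion (`hamiltonian`): a Hamiltonian cycle, provided Vs ≠ [].

module CycleJoining {A : Set} (_≟_ : DecidableEquality A) (Vs : List A)
  (E : A → A → Set) (σ : A → A)
  (σ-closed : ∀ {v} → v ∈ Vs → σ v ∈ Vs)
  (σ-injective : ∀ {u v} → u ∈ Vs → v ∈ Vs → σ u ≡ σ v → u ≡ v)
  (σ-edge : ∀ {v} → v ∈ Vs → E v (σ v))
  {Key : Set} (key : A → Key) (_≟K_ : DecidableEquality Key)
  (transfer : ∀ {u u' w} → u' ∈ Vs → key u ≡ key u' → E u w → E u' w)
  (in-similar : ∀ {u p w} → E u w → E p w → key u ≡ key p)
  (connected : (S : A → Set) → (∀ {u w} → S u → w ∈ Vs → E u w → S w) →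
               ∀ {u v} → u ∈ Vs → S u → v ∈ Vs → S v)
  where

  open Multiplicity _≟_
  open DecMembership _≟_ using (_∈?_)

  Step : A → A → Set
  Step a b = b ≡ σ a

  σ-walk-edges : ∀ {a L b} → Walk Step a L b → a ∈ Vs → Walk E a L b
  σ-walk-edges [] _ = []
  σ-walk-edges (refl ∷ w) aV = σ-edge aV ∷ σ-walk-edges w (σ-closed aV)

  σ-walk-⊆Vs : ∀ {a L b} → Walk Step a L b → a ∈ Vs → ∀ {x} → x ∈ a ∷ L → x ∈ Vs
  σ-walk-⊆Vs w aV (here refl) = aV
  σ-walk-⊆Vs (refl ∷ w) aV (there m) = σ-walk-⊆Vs w (σ-closed aV) m

  σ-walk-pred : ∀ {a y b} xs → Walk Step a (xs ++ [ y ]) b → Σ A λ p → p ∈ a ∷ xs × y ≡ σ p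
  σ-walk-pred [] (e ∷ []) = _ , here refl , e
  σ-walk-pred (x ∷ xs) (e ∷ w) = let p , m , q = σ-walk-pred xs w in p , there m , q

  σ-walk-succ : ∀ {a L b y} → Walk Step a L b → y ∈ a ∷ L → y ≡ b ⊎ σ y ∈ L
  σ-walk-succ [] (here refl) = inj₁ refl
  σ-walk-succ (e ∷ w) (here refl) = inj₂ (here (sym e))
  σ-walk-succ (e ∷ w) (there m) with σ-walk-succ w m
  ... | inj₁ q = inj₁ q
  ... | inj₂ q = inj₂ (there q)

  σ-cycle-closed : ∀ {a L y} → Walk Step a L a → y ∈ L → σ y ∈ L
  σ-cycle-closed {a} {l ∷ L} w m with σ-walk-succ w (there m)
  ... | inj₂ q = q
  σ-cycle-closed {a} {l ∷ L} (e ∷ w) m | inj₁ refl = here (sym e)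

  σ-walk-stays : ∀ {a L b y} (C : List A) → (∀ {x} → x ∈ C → σ x ∈ C) →
                 Walk Step a L b → y ∈ a ∷ L → y ∈ C → b ∈ C
  σ-walk-stays C cl [] (here refl) yC = yC
  σ-walk-stays C cl (e ∷ w) (here refl) yC = σ-walk-stays C cl w (here refl) (subst (_∈ C) (sym e) (cl yC))
  σ-walk-stays C cl (e ∷ w) (there m) yC = σ-walk-stays C cl w m yC

  -- A repetition-free σ-path v … x can only close up at v: if σ x were
  -- listed in P, it would be σ of its predecessor p there, so x = p by
  -- injectivity, and x would occur twice on the path.
  σ-path-returns-to-start : ∀ v P x → Walk Step v P x → Distinct (v ∷ P) → v ∈ Vs → σ x ∈ P → ⊥
  σ-path-returns-to-start v P x w d vV m with ∈-∃++ m
  ... | xs , ys , refl with walk-split xs w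
  ... | w1 , w2 with σ-walk-pred xs w1
  ... | p , p∈ , eq with σ-injective (σ-walk-⊆Vs w vV (walk-end∈ w)) (σ-walk-⊆Vs w1 vV (prefix p∈)) eq
    where
    prefix : ∀ {y} → y ∈ v ∷ xs → y ∈ v ∷ xs ++ [ σ x ]
    prefix (here e) = here e
    prefix (there q) = there (∈-++⁺ˡ q)
  ... | refl = distinct-disjoint (v ∷ xs) (σ x ∷ ys) d p∈ (walk-end∈ w2)

  -- The number of vertices of Vs not in L: the termination measure.
  outside : List A → ℕ
  outside L = sumL (λ w → ind (¬? (w ∈? L))) Vs

  outside-shrinks : ∀ {L L' y} → (∀ {w} → w ∈ L → w ∈ L') → y ∈ Vs → y ∈ L' → y ∉ L →
                    outside L' < outside L
  outside-shrinks {L} {L'} {y} sub yV yL' y∉L = sumL-strict Vs pointwise yV strict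
    where
    pointwise : ∀ w → ind (¬? (w ∈? L')) ≤ ind (¬? (w ∈? L))
    pointwise w with w ∈? L' | w ∈? L
    ... | yes _ | _ = z≤n
    ... | no _ | no _ = ≤-refl
    ... | no n | yes m = ⊥-elim (n (sub m))
    strict : ind (¬? (y ∈? L')) < ind (¬? (y ∈? L))
    strict with y ∈? L' | y ∈? L
    ... | yes _ | no _ = s≤s z≤n
    ... | no n | _ = ⊥-elim (n yL')
    ... | yes _ | yes m = ⊥-elim (y∉L m)

  record Orbit (v : A) : Set where
    field
      L : List A
      walk : Walk Step v L v
      distinct : Distinct L
      ⊆Vs : ∀ {x} → x ∈ L → x ∈ Vs
      start : v ∈ L

  -- Extend the σ-path v ∷ P ending in x until it closes up; the fuel
  -- bounds the number of vertices still outside the path.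
  orbit-from : ∀ (fuel : ℕ) v (P : List A) x → Walk Step v P x → Distinct (v ∷ P) →
               v ∈ Vs → outside (v ∷ P) < fuel → Orbit v
  orbit-from (suc fuel) v P x w d vV (s≤s lt) with σ x ∈? (v ∷ P)
  ... | yes (here eq) = record
        { L = P ++ [ v ] ; walk = closed ; distinct = distinct-swap [ v ] P d
        ; ⊆Vs = λ m → σ-walk-⊆Vs closed vV (there m) ; start = ∈-++⁺ʳ P (here refl) }
    where closed = walk-snoc w (sym eq)
  ... | yes (there m) = ⊥-elim (σ-path-returns-to-start v P x w d vV m)
  ... | no σx∉ = orbit-from fuel v (P ++ [ σ x ]) (σ x) (walk-snoc w refl) d' vV
                   (<-≤-trans (outside-shrinks ∈-++⁺ˡ σxV (∈-++⁺ʳ (v ∷ P) (here refl)) σx∉) lt)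
    where
    σxV = σ-closed (σ-walk-⊆Vs w vV (walk-end∈ w))
    d' : Distinct (v ∷ P ++ [ σ x ])
    d' = distinct-++ (v ∷ P) [ σ x ] d distinct-[ σ x ] (λ m → λ { (here refl) → σx∉ m })

  orbit : ∀ {v} → v ∈ Vs → Orbit v
  orbit {v} vV = orbit-from (suc (outside [ v ])) v [] v [] distinct-[ v ] vV ≤-refl

  σ-walk-last : ∀ {a l L b} → Walk Step a (l ∷ L) b → Σ A λ p → p ∈ a ∷ l ∷ L × b ≡ σ p
  σ-walk-last (e ∷ []) = _ , here refl , e
  σ-walk-last (e ∷ (e' ∷ w)) = let p , m , q = σ-walk-last (e' ∷ w) in p , there m , q

  -- σ is onto Vs: w is the σ-image of its predecessor on its own orbit.
  σ-onto : ∀ {w} → w ∈ Vs → Σ A λ p → p ∈ Vs × w ≡ σ p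
  σ-onto wV with orbit wV
  ... | record { L = l ∷ L ; walk = walk } =
    let p , p∈ , eq = σ-walk-last walk in p , σ-walk-⊆Vs walk wV p∈ , eq

  -- The state of the joining process: a repetition-free closed E-walk
  -- through z visiting C ⊆ Vs, where C is a union of σ-orbits.
  record JoinedCycle : Set where
    field
      C : List A
      z : A
      walk : Walk E z C z
      z∈C : z ∈ C
      distinct : Distinct C
      ⊆Vs : ∀ {x} → x ∈ C → x ∈ Vs
      σ-stable : ∀ {x} → x ∈ C → σ x ∈ C

  open JoinedCycle

  orbit-cycle : ∀ {v} → v ∈ Vs → JoinedCycle
  orbit-cycle vV = record
    { C = Orbit.L D ; z = _ ; walk = σ-walk-edges (Orbit.walk D) vV ; z∈C = Orbit.start D
    ; distinct = Orbit.distinct D ; ⊆Vs = Orbit.⊆Vs D ; σ-stable = σ-cycle-closed (Orbit.walk D) }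
    where D = orbit vV

  -- A nonempty walk from a may start from any vertex similar to a instead,
  -- since similar vertices have the same out-neighbours.
  retarget : ∀ {a a' L b x} → Walk E a L b → x ∈ L → a' ∈ Vs → key a ≡ key a' → Walk E a' L b
  retarget (e ∷ w) _ a'V k = transfer a'V k e ∷ w

  -- Let u lie on the joined cycle C and u' ∉ C be similar to u.
  -- The orbit D of u' avoids C (C is σ-closed), and the walk
  -- u → (D from u' back to u') → (C rotated to start at u) closes up,
  -- since the first edges of both parts may be exchanged by `retarget`.
  splice : (J : JoinedCycle) → ∀ {u u'} → u ∈ C J → u' ∈ Vs → key u ≡ key u' → u' ∉ C J →
           Σ JoinedCycle λ J' → outside (C J') < outside (C J)
  splice J {u} {u'} u∈C u'V k u'∉C = J' , outside-shrinks grows u'V (∈-++⁺ˡ (Orbit.start D)) u'∉C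
    where
    D = orbit u'V
    DL = Orbit.L D
    rotated = rotate _≟_ (walk J) u∈C
    C' = proj₁ rotated
    C'-walk = proj₁ (proj₂ rotated)
    u∈C' = proj₁ (proj₂ (proj₂ rotated))
    C'-mult = proj₂ (proj₂ (proj₂ rotated))
    C'⊆C : ∀ {x} → x ∈ C' → x ∈ C J
    C'⊆C = same-mult⇒⊆ C'-mult
    C⊆C' : ∀ {x} → x ∈ C J → x ∈ C'
    C⊆C' = same-mult⇒⊆ (λ x → sym (C'-mult x))
    D-avoids-C : ∀ {x} → x ∈ DL → x ∉ C J
    D-avoids-C m xC = u'∉C (σ-walk-stays (C J) (σ-stable J) (Orbit.walk D) (there m) xC)
    N = DL ++ C'
    N-walk : Walk E u N u
    N-walk = walk-++ (retarget (σ-walk-edges (Orbit.walk D) u'V) (Orbit.start D) (⊆Vs J u∈C) (sym k))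
                     (retarget C'-walk u∈C' u'V k)
    N-distinct : Distinct N
    N-distinct = distinct-++ DL C' (Orbit.distinct D) (λ x → subst (_≤ 1) (sym (C'-mult x)) (distinct J x))
                   (λ m m' → D-avoids-C m (C'⊆C m'))
    N-⊆Vs : ∀ {x} → x ∈ N → x ∈ Vs
    N-⊆Vs m with ∈-++⁻ DL m
    ... | inj₁ q = Orbit.⊆Vs D q
    ... | inj₂ q = ⊆Vs J (C'⊆C q)
    N-σ-closed : ∀ {x} → x ∈ N → σ x ∈ N
    N-σ-closed m with ∈-++⁻ DL m
    ... | inj₁ q = ∈-++⁺ˡ (σ-cycle-closed (Orbit.walk D) q)
    ... | inj₂ q = ∈-++⁺ʳ DL (C⊆C' (σ-stable J (C'⊆C q)))
    J' : JoinedCycle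
    J' = record { C = N ; z = u ; walk = N-walk ; z∈C = ∈-++⁺ʳ DL u∈C' ; distinct = N-distinct
                ; ⊆Vs = N-⊆Vs ; σ-stable = N-σ-closed }
    grows : ∀ {x} → x ∈ C J → x ∈ N
    grows m = ∈-++⁺ʳ DL (C⊆C' m)

  Joinable : JoinedCycle → Set
  Joinable J = Any (λ u → Any (λ u' → key u ≡ key u' × u' ∉ C J) Vs) (C J)

  -- It is closed under
  -- out-edges: for an edge u → w with u ∈ C, write w = σ p; then p is an
  -- in-neighbour of w like u, so p is similar to u, hence p ∈ C and
  -- w = σ p ∈ C.  Strong connectivity then gives C ⊇ Vs.
  unjoinable-hamiltonian : (J : JoinedCycle) → ¬ Joinable J → HamiltonianCycle _≟_ Vs E
  unjoinable-hamiltonian J stuck = record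
    { H = C J ; z = z J ; walk = walk J ; distinct = distinct J ; ⊆Vs = ⊆Vs J
    ; covers = λ xV → connected (_∈ C J) out-closed (⊆Vs J (z∈C J)) (z∈C J) xV }
    where
    out-closed : ∀ {u w} → u ∈ C J → w ∈ Vs → E u w → w ∈ C J
    out-closed {u} u∈C wV e with σ-onto wV
    ... | p , pV , refl with p ∈? C J
    ... | yes p∈C = σ-stable J p∈C
    ... | no p∉C = ⊥-elim (stuck (lose u∈C (lose pV (in-similar e (σ-edge pV) , p∉C))))

  -- Splice while possible; each splice adds an orbit, so at most
  -- `outside C` splices happen.
  join : (fuel : ℕ) → (J : JoinedCycle) → outside (C J) < fuel → HamiltonianCycle _≟_ Vs E
  join (suc fuel) J (s≤s lt)
    with any? (λ u → any? (λ u' → (key u ≟K key u') ×-dec ¬? (u' ∈? C J)) Vs) (C J)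
  ... | no stuck = unjoinable-hamiltonian J stuck
  ... | yes joinable with DecMembership.find _≟_ joinable
  ... | u , u∈C , similar with DecMembership.find _≟_ similar
  ... | u' , u'V , (k , u'∉C) with splice J u∈C u'V k u'∉C
  ... | J' , lt' = join fuel J' (<-≤-trans lt' lt)

  hamiltonian : ∀ {v} → v ∈ Vs → HamiltonianCycle _≟_ Vs E
  hamiltonian vV = join (suc (outside (C J₀))) J₀ ≤-refl
    where J₀ = orbit-cycle vV

-- Shifting a letter c into a window x drops the first letter
-- and appends c; shifting in a whole word cs shows the last |x| letters
-- of x ++ cs.  This is how paths between arbitrary vertices are built.

module _ {A : Set} where
  toList-inj : ∀ {k} (x y : Vec A k) → toList x ≡ toList y → x ≡ y
  toList-inj x y e = trans (sym (cast-is-id refl x)) (toList-injective refl x y e)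

  shift : ∀ {k} → Vec A (suc k) → A → Vec A (suc k)
  shift x c = tail x ∷ʳ c

  shiftAll : ∀ {k j} → Vec A (suc k) → Vec A j → Vec A (suc k)
  shiftAll x [] = x
  shiftAll x (c ∷ cs) = shiftAll (shift x c) cs

  shiftAll-window : ∀ {k j} (x : Vec A (suc k)) (cs : Vec A j) →
                    toList (shiftAll x cs) ≡ drop j (toList x ++ toList cs)
  shiftAll-window x [] = cong (drop 0) (sym (++-identityʳ (toList x)))
  shiftAll-window {k} {suc j} (a ∷ t) (c ∷ cs) =
    trans (shiftAll-window (t ∷ʳ c) cs)
      (cong (drop j) (trans (cong (_++ toList cs) (toList-∷ʳ c t)) (++-assoc (toList t) [ c ] (toList cs))))

  drop-prefix : ∀ {k} (x : Vec A k) ys → drop k (toList x ++ ys) ≡ ys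
  drop-prefix [] ys = refl
  drop-prefix (a ∷ x) ys = drop-prefix x ys

  shiftAll-full : ∀ {k} (x y : Vec A (suc k)) → shiftAll x y ≡ y
  shiftAll-full x y = toList-inj _ _ (trans (shiftAll-window x y) (drop-prefix x (toList y)))

  shiftAll-keep-last : ∀ {k} (x : Vec A (suc (suc k))) (y : Vec A (suc k)) → shiftAll x y ≡ last x ∷ y
  shiftAll-keep-last {k} x y with initLast x
  ... | ys , l , refl = toList-inj _ _ (begin
      toList (shiftAll (ys ∷ʳ l) y)                ≡⟨ shiftAll-window (ys ∷ʳ l) y ⟩
      drop (suc k) (toList (ys ∷ʳ l) ++ toList y)  ≡⟨ cong (λ z → drop (suc k) (z ++ toList y)) (toList-∷ʳ l ys) ⟩
      drop (suc k) ((toList ys ++ [ l ]) ++ toList y) ≡⟨ cong (drop (suc k)) (++-assoc (toList ys) [ l ] (toList y)) ⟩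
      drop (suc k) (toList ys ++ l ∷ toList y)     ≡⟨ drop-prefix ys (l ∷ toList y) ⟩
      l ∷ toList y                                 ∎)
    where open ≡-Reasoning

  tail-init : ∀ {k} (W : Vec A (suc (suc k))) → tail (init W) ≡ init (tail W)
  tail-init (a ∷ b ∷ W) = refl

_≟S_ : ∀ {s k} → DecidableEquality (Str s k)
_≟S_ = ≡-dec _≟F_

allStr-complete : ∀ {s k} (v : Str s k) → v ∈ allStr s k
allStr-complete [] = here refl
allStr-complete {s} {suc k} (x ∷ v) =
  ∈-concatMap⁺ (λ y → map (y ∷_) (allStr s k)) (lose (∈-allFin x) (∈-map⁺ (x ∷_) (allStr-complete v)))

allFin-distinct : ∀ s → Multiplicity.Distinct _≟F_ (allFin s)
allFin-distinct s = Multiplicity.Unique⇒distinct _≟F_ (allFin⁺ s)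

ind-≟-∷ : ∀ {s k} (x y : Fin s) (w w' : Str s k) → ind ((x ∷ w) ≟S (y ∷ w')) ≡ ind (x ≟F y) * ind (w ≟S w')
ind-≟-∷ x y w w' = bit-∧ (does (x ≟F y)) (does (w ≟S w'))

allStr-distinct : ∀ s k → Multiplicity.Distinct _≟S_ (allStr s k)
allStr-distinct s zero [] = s≤s z≤n
allStr-distinct s (suc k) (x ∷ w) = begin
    Multiplicity.mult _≟S_ (x ∷ w) (allStr s (suc k))
  ≡⟨ sumL-concatMap _ (λ y → map (y ∷_) (allStr s k)) (allFin s) ⟩
    sumL (λ y → sumL (λ v → ind ((x ∷ w) ≟S v)) (map (y ∷_) (allStr s k))) (allFin s)
  ≡⟨ sumL-cong (allFin s) (λ {y} _ → trans (sumL-map _ (y ∷_) (allStr s k))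
       (trans (sumL-cong (allStr s k) (λ {w'} _ → ind-≟-∷ x y w w')) (sumL-*ˡ (ind (x ≟F y)) _ (allStr s k)))) ⟩
    sumL (λ y → ind (x ≟F y) * Multiplicity.mult _≟S_ w (allStr s k)) (allFin s)
  ≤⟨ sumL-mono (allFin s) (λ y → ≤-trans (*-monoʳ-≤ (ind (x ≟F y)) (allStr-distinct s k w)) (≤-reflexive (*-identityʳ _))) ⟩
    Multiplicity.mult _≟F_ x (allFin s)
  ≤⟨ allFin-distinct s x ⟩
    1 ∎
  where open ≤-Reasoning

module Graph (K : Kind) (m k : ℕ) where
  V : Set
  V = Str (alphabet K m) (suc k)

  Vs : List V
  Vs = filter (valid? K m) (allStr (alphabet K m) (suc k))

  E : V → V → Set
  E = Edge K m (suc k)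

  ∈Vs : ∀ {v : V} → Valid K m v → v ∈ Vs
  ∈Vs {v} p = ∈-filter⁺ (valid? K m) (allStr-complete v) p

  valid : ∀ {v : V} → v ∈ Vs → Valid K m v
  valid p = proj₂ (∈-filter⁻ (valid? K m) {xs = allStr (alphabet K m) (suc k)} p)

  Vs-distinct : Multiplicity.Distinct _≟S_ Vs
  Vs-distinct = Multiplicity.distinct-filter _≟S_ (valid? K m) (allStr (alphabet K m) (suc k)) (allStr-distinct (alphabet K m) (suc k))

  -- All in-neighbours of a vertex w are similar: their tails are init w.
  in-similar : ∀ {u p w} → E u w → E p w → tail u ≡ tail p
  in-similar (W , _ , refl , refl) (W' , _ , refl , e') = trans (tail-init W) (sym (trans (tail-init W') (cong init e')))

module _ {s : ℕ} where
  kautz-tail : ∀ {k x} {w : Str s k} → KautzStr (x ∷ w) → KautzStr w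
  kautz-tail (kz-one x) = kz-nil
  kautz-tail (kz-cons _ _ _ _ k) = k

  kautz-head : ∀ {k a b} {t : Str s k} → KautzStr (a ∷ b ∷ t) → ¬ a ≡ b
  kautz-head (kz-cons _ _ _ ne _) = ne

  kautz-snoc : ∀ {k} (v : Str s (suc k)) c → KautzStr v → ¬ last v ≡ c → KautzStr (v ∷ʳ c)
  kautz-snoc (a ∷ []) c _ ne = kz-cons a c [] ne (kz-one c)
  kautz-snoc (a ∷ b ∷ t) c (kz-cons _ _ _ ab k) ne = kz-cons a b (t ∷ʳ c) ab (kautz-snoc (b ∷ t) c k ne)

valid-tail : ∀ K m {k} {v : Str (alphabet K m) (suc k)} → Valid K m v → Valid K m (tail v)
valid-tail deBruijn m _ = tt
valid-tail kautz m {v = _ ∷ _} p = kautz-tail p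

-- Gluing along an overlap: if p₁ P' and Q are valid and P' = init Q, then
-- p₁ Q is valid (for Kautz: p₁ differs from the head of P' = head of Q).
valid-glue : ∀ K m {k p₁} {P' : Str (alphabet K m) (suc k)} {Q : Str (alphabet K m) (suc (suc k))} →
             Valid K m (p₁ ∷ P') → Valid K m Q → P' ≡ init Q → Valid K m (p₁ ∷ Q)
valid-glue deBruijn m _ _ _ = tt
valid-glue kautz m {p₁ = p₁} {_ ∷ _} {q₁ ∷ Q'} vp vq e =
  kz-cons p₁ q₁ Q' (λ q → kautz-head vp (trans q (sym (∷-injectiveˡ e)))) vq

-- DB_{k+1}(m), m ≥ 1: σ rotates a string cyclically (a t ↦ t a); every
-- shift is an edge, so any vertex reaches any other in k+1 steps.

module DeBruijn (m' k : ℕ) where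
  open Graph deBruijn (suc m') k

  σ : V → V
  σ v = shift v (head v)

  σ-injective : ∀ {u v} → u ∈ Vs → v ∈ Vs → σ u ≡ σ v → u ≡ v
  σ-injective {a ∷ t} {b ∷ t'} _ _ e with ∷ʳ-injective t t' e
  ... | refl , refl = refl

  shift-edge : ∀ (x : V) c → E x (shift x c)
  shift-edge (a ∷ t) c = (a ∷ t) ∷ʳ c , tt , init-∷ʳ c (a ∷ t) , refl

  transfer : ∀ {u u' w} → u' ∈ Vs → tail u ≡ tail u' → E u w → E u' w
  transfer {u' = a' ∷ t'} _ k (x ∷ y ∷ W , _ , refl , refl) = a' ∷ y ∷ W , tt , cong (a' ∷_) k , refl

  connected : (S : V → Set) → (∀ {u w} → S u → w ∈ Vs → E u w → S w) →
              ∀ {u v} → u ∈ Vs → S u → v ∈ Vs → S v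
  connected S closed {u} {v} _ su _ = subst S (shiftAll-full u v) (shifts u v su)
    where
    shifts : ∀ {j} x (cs : Vec (Fin (suc m')) j) → S x → S (shiftAll x cs)
    shifts x [] sx = sx
    shifts x (c ∷ cs) sx = shifts (shift x c) cs (closed sx (∈Vs tt) (shift-edge x c))

  open CycleJoining _≟S_ Vs E σ (λ _ → ∈Vs tt) σ-injective (λ {v} _ → shift-edge v (head v))
         tail _≟S_ transfer in-similar connected

  hamiltonian-cycle : HamiltonianCycle _≟S_ Vs E
  hamiltonian-cycle = hamiltonian (∈Vs {replicate _ zero} tt)

-- Kautz_{k+2}(m), m ≥ 1, over the letters Fin (m+1).  σ drops the first
-- letter a of a b t and appends a again, unless a equals the last letter,
-- in which case it appends b (≠ a).  Given b t, the appended letter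
-- determines a, so σ is injective.

module Kautz (m' k : ℕ) where
  open Graph kautz (suc m') (suc k)

  Letter : Set
  Letter = Fin (suc (suc m'))

  appended : ∀ {j} (a b : Letter) (t : Vec Letter j) → Letter
  appended a b t with a ≟F last (b ∷ t)
  ... | yes _ = b
  ... | no _ = a

  appended-fresh : ∀ {j} a b (t : Vec Letter j) → ¬ a ≡ b → ¬ last (b ∷ t) ≡ appended a b t
  appended-fresh a b t a≢b with a ≟F last (b ∷ t)
  ... | yes e = λ q → a≢b (trans e q)
  ... | no ne = λ q → ne (sym q)

  appended-injective : ∀ {j} a a' b (t : Vec Letter j) → ¬ a ≡ b → ¬ a' ≡ b →
                       appended a b t ≡ appended a' b t → a ≡ a'
  appended-injective a a' b t a≢b a'≢b eq with a ≟F last (b ∷ t) | a' ≟F last (b ∷ t)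
  ... | yes e | yes e' = trans e (sym e')
  ... | yes e | no _ = ⊥-elim (a'≢b (sym eq))
  ... | no _ | yes e' = ⊥-elim (a≢b eq)
  ... | no _ | no _ = eq

  σ : V → V
  σ (a ∷ b ∷ t) = (b ∷ t) ∷ʳ appended a b t

  σ-string : ∀ {v} → v ∈ Vs → KautzStr (v ∷ʳ appended (head v) (head (tail v)) (tail (tail v)))
  σ-string {a ∷ b ∷ t} vV = kautz-snoc (a ∷ b ∷ t) _ (valid vV) (appended-fresh a b t (kautz-head (valid vV)))

  σ-closed : ∀ {v} → v ∈ Vs → σ v ∈ Vs
  σ-closed {a ∷ b ∷ t} vV = ∈Vs (kautz-tail (σ-string {a ∷ b ∷ t} vV))

  σ-injective : ∀ {u v} → u ∈ Vs → v ∈ Vs → σ u ≡ σ v → u ≡ v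
  σ-injective {a ∷ b ∷ t} {a' ∷ b' ∷ t'} uV vV e with ∷ʳ-injective (b ∷ t) (b' ∷ t') e
  ... | refl , e2 = cong (_∷ b ∷ t) (appended-injective a a' b t (kautz-head (valid uV)) (kautz-head (valid vV)) e2)

  σ-edge : ∀ {v} → v ∈ Vs → E v (σ v)
  σ-edge {a ∷ b ∷ t} vV = (a ∷ b ∷ t) ∷ʳ appended a b t , σ-string {a ∷ b ∷ t} vV , init-∷ʳ _ (a ∷ b ∷ t) , refl

  -- An edge u → w is u followed by a letter ≠ last u; replacing the first
  -- letter by that of a similar Kautz vertex u' keeps it a Kautz string.
  transfer : ∀ {u u' w} → u' ∈ Vs → tail u ≡ tail u' → E u w → E u' w
  transfer {u' = a' ∷ b' ∷ t'} u'V k (x ∷ y ∷ z ∷ W , vW , refl , refl) =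
    a' ∷ y ∷ z ∷ W , kz-cons a' y (z ∷ W) a'≢y (kautz-tail vW) , cong (a' ∷_) k , refl
    where
    a'≢y : ¬ a' ≡ y
    a'≢y q = kautz-head (valid u'V) (trans q (∷-injectiveˡ k))

  shifts : (S : V → Set) → (∀ {u w} → S u → w ∈ Vs → E u w → S w) →
           ∀ {j} x (cs : Vec Letter j) → S x → KautzStr x → KautzStr (last x ∷ cs) → S (shiftAll x cs)
  shifts S closed x [] sx _ _ = sx
  shifts S closed (a ∷ t) (c ∷ cs) sx kx (kz-cons _ _ _ ne kc) =
    shifts S closed (t ∷ʳ c) cs (closed sx (∈Vs (kautz-tail kW)) ((a ∷ t) ∷ʳ c , kW , init-∷ʳ c (a ∷ t) , refl))
      (kautz-tail kW) (subst (λ z → KautzStr (z ∷ cs)) (sym (last-∷ʳ c t)) kc)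
    where kW = kautz-snoc (a ∷ t) c kx ne

  -- To reach v = v₁ v' from u: shift in all of v, or only v' when v₁ is
  -- already the last letter of u.
  connected : (S : V → Set) → (∀ {u w} → S u → w ∈ Vs → E u w → S w) →
              ∀ {u v} → u ∈ Vs → S u → v ∈ Vs → S v
  connected S closed {u} {v₁ ∷ v'} uV su vV with v₁ ≟F last u
  ... | yes e = subst S (trans (shiftAll-keep-last u v') (cong (_∷ v') (sym e)))
                  (shifts S closed u v' su (valid uV) (subst (λ z → KautzStr (z ∷ v')) e (valid vV)))
  ... | no ne = subst S (shiftAll-full u (v₁ ∷ v'))
                  (shifts S closed u (v₁ ∷ v') su (valid uV) (kz-cons (last u) v₁ v' (λ q → ne (sym q)) (valid vV)))

  flip : Letter → Letter
  flip zero = suc zero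
  flip (suc _) = zero

  alternating : ∀ j → Letter → Vec Letter j
  alternating zero x = []
  alternating (suc j) x = x ∷ alternating j (flip x)

  alternating-kautz : ∀ j x → KautzStr (alternating j x)
  alternating-kautz zero x = kz-nil
  alternating-kautz (suc zero) x = kz-one x
  alternating-kautz (suc (suc j)) zero = kz-cons zero (suc zero) _ (λ ()) (alternating-kautz (suc j) (suc zero))
  alternating-kautz (suc (suc j)) (suc x) = kz-cons (suc x) zero _ (λ ()) (alternating-kautz (suc j) zero)

  open CycleJoining _≟S_ Vs E σ σ-closed σ-injective σ-edge tail _≟S_ transfer in-similar connected

  hamiltonian-cycle : HamiltonianCycle _≟S_ Vs E
  hamiltonian-cycle = hamiltonian (∈Vs (alternating-kautz (suc (suc k)) zero))

-- Kautz_1(m) is the complete digraph on the m+1 letters; the letters in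
-- increasing order, closed up by the edge from the last letter to 0, form
-- a Hamiltonian cycle.

-- The letters in increasing order, in a form suited to induction; it is
-- the library enumeration `allFin`.
enum : ∀ k → List (Fin k)
enum zero = []
enum (suc k) = zero ∷ map suc (enum k)

enum≡allFin : ∀ k → enum k ≡ allFin k
enum≡allFin zero = refl
enum≡allFin (suc k) = cong (zero ∷_) (trans (cong (map suc) (enum≡allFin k)) (map-tabulate (λ i → i) suc))

Different : ∀ {k} → Fin k → Fin k → Set
Different a b = ¬ a ≡ b

walk-enum : ∀ k → Walk (Different {suc k}) zero (map suc (enum k)) (fromℕ k)
walk-enum zero = []
walk-enum (suc k) = (λ ()) ∷ walk-suc (walk-enum k)
  where
  walk-suc : ∀ {k a b L} → Walk (Different {k}) a L b → Walk (Different {suc k}) (suc a) (map suc L) (suc b)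
  walk-suc [] = []
  walk-suc (ne ∷ w) = (λ q → ne (Fin-suc-injective q)) ∷ walk-suc w

module KautzSingle (m' : ℕ) where
  open Graph kautz (suc m') zero

  single : Fin (suc (suc m')) → V
  single x = x ∷ []

  H : List V
  H = map single (enum (suc (suc m')))

  -- A walk through letters with consecutive ones different is a walk in
  -- Kautz_1, since every two-letter Kautz string is an edge.
  single-walk : ∀ {a b L} → Walk Different a L b → Walk E (single a) (map single L) (single b)
  single-walk [] = []
  single-walk {a} (_∷_ {b = b} ne w) = (a ∷ b ∷ [] , kz-cons a b [] ne (kz-one b) , refl , refl) ∷ single-walk w

  H-distinct : Multiplicity.Distinct _≟S_ H
  H-distinct (x ∷ []) = begin
      sumL (λ y → ind ((x ∷ []) ≟S y)) (map single letters)    ≡⟨ sumL-map (λ y → ind ((x ∷ []) ≟S y)) single letters ⟩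
      sumL (λ y → ind ((x ∷ []) ≟S (y ∷ []))) letters           ≡⟨ sumL-cong letters (λ {y} _ → trans (ind-≟-∷ x y [] []) (*-identityʳ (ind (x ≟F y)))) ⟩
      Multiplicity.mult _≟F_ x letters                        ≤⟨ subst (λ L → Multiplicity.mult _≟F_ x L ≤ 1) (sym (enum≡allFin _)) (allFin-distinct _ x) ⟩
      1                                                       ∎
    where
    open ≤-Reasoning
    letters = enum (suc (suc m'))

  hamiltonian-cycle : HamiltonianCycle _≟S_ Vs E
  hamiltonian-cycle = record
    { H = H ; z = _ ; walk = single-walk ((λ ()) ∷ walk-enum (suc m')) ; distinct = H-distinct
    ; ⊆Vs = H⊆Vs ; covers = λ {x} _ → Vs⊆H x }
    where
    H⊆Vs : ∀ {x} → x ∈ H → x ∈ Vs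
    H⊆Vs q with ∈-map⁻ single q
    ... | y , _ , refl = ∈Vs (kz-one y)
    Vs⊆H : ∀ x → x ∈ H
    Vs⊆H (y ∷ []) = ∈-map⁺ single (subst (y ∈_) (sym (enum≡allFin _)) (∈-allFin y))

-- Counting vertices: |V(G_{k+2})| = |V(G_{k+1})| · m, since a valid string
-- w of length k+1 has exactly m valid left extensions y w (all m letters
-- for DB; the m letters ≠ head w for Kautz), and an invalid one has none.

letters-other-than : ∀ m (y : Fin (suc m)) → sumL (λ x → ind (¬? (x ≟F y))) (allFin (suc m)) ≡ m
letters-other-than m y = +-cancelʳ-≡ 1 _ _ (begin
    sumL (λ x → ind (¬? (x ≟F y))) L + 1
  ≡⟨ cong (sumL (λ x → ind (¬? (x ≟F y))) L +_) (sym (Multiplicity.mult-distinct _≟F_ (allFin-distinct (suc m)) (∈-allFin y))) ⟩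
    sumL (λ x → ind (¬? (x ≟F y))) L + sumL (λ x → ind (y ≟F x)) L
  ≡⟨ cong (sumL (λ x → ind (¬? (x ≟F y))) L +_) (sumL-cong L (λ {x} _ → Multiplicity.≟-sym _≟F_ y x)) ⟩
    sumL (λ x → ind (¬? (x ≟F y))) L + sumL (λ x → ind (x ≟F y)) L
  ≡⟨ sym (sumL-+ (λ x → ind (¬? (x ≟F y))) (λ x → ind (x ≟F y)) L) ⟩
    sumL (λ x → ind (¬? (x ≟F y)) + ind (x ≟F y)) L
  ≡⟨ sumL-cong L (λ {x} _ → ind-¬ (x ≟F y)) ⟩
    sumL (λ _ → 1) L
  ≡⟨ sumL-1 L ⟩
    length L
  ≡⟨ length-tabulate (λ i → i) ⟩
    suc m
  ≡⟨ +-comm 1 m ⟩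
    m + 1 ∎)
  where
  open ≡-Reasoning
  L = allFin (suc m)

ind-kautz-∷∷ : ∀ {s k} (x y : Fin s) (w : Str s k) →
               ind (kautz? (x ∷ y ∷ w)) ≡ ind (¬? (x ≟F y)) * ind (kautz? (y ∷ w))
ind-kautz-∷∷ x y w with x ≟F y | kautz? (y ∷ w)
... | yes _ | _ = refl
... | no _ | yes _ = refl
... | no _ | no _ = refl

left-extensions : ∀ K m {k} (w : Str (alphabet K m) (suc k)) →
                  sumL (λ y → ind (valid? K m (y ∷ w))) (allFin (alphabet K m)) ≡ ind (valid? K m w) * m
left-extensions deBruijn m w = trans (sumL-1 (allFin m)) (trans (length-tabulate (λ i → i)) (sym (+-identityʳ m)))
left-extensions kautz m (y₀ ∷ w) = begin
    sumL (λ y → ind (kautz? (y ∷ y₀ ∷ w))) L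
  ≡⟨ sumL-cong L (λ {y} _ → trans (ind-kautz-∷∷ y y₀ w) (*-comm _ (ind (kautz? (y₀ ∷ w))))) ⟩
    sumL (λ y → ind (kautz? (y₀ ∷ w)) * ind (¬? (y ≟F y₀))) L
  ≡⟨ sumL-*ˡ (ind (kautz? (y₀ ∷ w))) _ L ⟩
    ind (kautz? (y₀ ∷ w)) * sumL (λ y → ind (¬? (y ≟F y₀))) L
  ≡⟨ cong (ind (kautz? (y₀ ∷ w)) *_) (letters-other-than m y₀) ⟩
    ind (kautz? (y₀ ∷ w)) * m ∎
  where
  open ≡-Reasoning
  L = allFin (suc m)

numVertices-step : ∀ K m k → numVertices K m (suc (suc k)) ≡ numVertices K m (suc k) * m
numVertices-step K m k = begin
    numVertices K m (suc (suc k))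
  ≡⟨ length-filter (valid? K m) (allStr s (suc (suc k))) ⟩
    sumL [valid] (allStr s (suc (suc k)))
  ≡⟨ sumL-concatMap [valid] (λ y → map (y ∷_) (allStr s (suc k))) (allFin s) ⟩
    sumL (λ y → sumL [valid] (map (y ∷_) (allStr s (suc k)))) (allFin s)
  ≡⟨ sumL-cong (allFin s) (λ {y} _ → sumL-map [valid] (y ∷_) (allStr s (suc k))) ⟩
    sumL (λ y → sumL (λ w → [valid] (y ∷ w)) (allStr s (suc k))) (allFin s)
  ≡⟨ sumL-swap (λ y w → [valid] (y ∷ w)) (allFin s) (allStr s (suc k)) ⟩
    sumL (λ w → sumL (λ y → [valid] (y ∷ w)) (allFin s)) (allStr s (suc k))
  ≡⟨ sumL-cong (allStr s (suc k)) (λ {w} _ → trans (left-extensions K m w) (*-comm _ m)) ⟩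
    sumL (λ w → m * ind (valid? K m w)) (allStr s (suc k))
  ≡⟨ sumL-*ˡ m _ (allStr s (suc k)) ⟩
    m * sumL (λ w → ind (valid? K m w)) (allStr s (suc k))
  ≡⟨ cong (m *_) (sym (length-filter (valid? K m) (allStr s (suc k)))) ⟩
    m * numVertices K m (suc k)
  ≡⟨ *-comm m _ ⟩
    numVertices K m (suc k) * m ∎
  where
  open ≡-Reasoning
  s = alphabet K m
  [valid] : Str s (suc (suc k)) → ℕ
  [valid] w = ind (valid? K m w)

ClassCycle : Kind → ℕ → ℕ → Set
ClassCycle K m k =
  Σ ℕ λ c' → (suc c' * m ≡ numVertices K m (suc k)) ×
    Σ (DirectedCycle K m (suc k) c') λ C →
      ∀ (v : Str (alphabet K m) (suc k)) → IsVertex K m (suc k) v →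
        Σ (Fin (suc c')) λ i → Similar (DirectedCycle.vtx C i) v ×
          (∀ j → Similar (DirectedCycle.vtx C j) v → j ≡ i)

module LineGraph (K : Kind) (m k : ℕ) where
  open Graph K m k

  V⁺ : Set
  V⁺ = Str (alphabet K m) (suc (suc k))

  Overlap : V⁺ → V⁺ → Set
  Overlap P Q = tail P ≡ init Q × Valid K m P × Valid K m Q

  overlap-edge : ∀ {P Q} → Overlap P Q → Edge K m (suc (suc k)) P Q
  overlap-edge {p₁ ∷ P'} {Q} (e , vP , vQ) = p₁ ∷ Q , valid-glue K m vP vQ e , cong (p₁ ∷_) (sym e) , refl

  lift-walk : ∀ {a b L} (P : V⁺) → tail P ≡ a → Valid K m P → Walk E a L b →
              Σ V⁺ λ Q → Σ (List V⁺) λ Ws → Walk Overlap P Ws Q × tail Q ≡ b × Valid K m Q × map tail Ws ≡ L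
  lift-walk P pa vP [] = P , [] , [] , pa , vP , refl
  lift-walk P pa vP ((W , vW , iW , tW) ∷ w) with lift-walk W tW vW w
  ... | Q , Ws , wQ , tQ , vQ , tails = Q , W ∷ Ws , (trans pa (sym iW) , vP , vW) ∷ wQ , tQ , vQ , cong₂ _∷_ tW tails

  walk-step : ∀ {a L b} → Walk Overlap a L b → (i : Fin (length L)) →
              Overlap (lookup (a ∷ L) (inject₁ i)) (lookup (a ∷ L) (suc i))
  walk-step (e ∷ w) zero = e
  walk-step (e ∷ w) (suc i) = walk-step w i

  walk-last : ∀ {a L b} → Walk Overlap a L b → lookup (a ∷ L) (fromℕ (length L)) ≡ b
  walk-last [] = refl
  walk-last (e ∷ w) = walk-last w

  walk-valid : ∀ {a L b} → Walk Overlap a L b → Valid K m a → (i : Fin (suc (length L))) → Valid K m (lookup (a ∷ L) i)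
  walk-valid w va zero = va
  walk-valid ((_ , _ , vb) ∷ w) va (suc i) = walk-valid w vb i

  open Multiplicity (_≟S_ {alphabet K m} {suc k})

  class-cycle : ∀ {W₁ Ws Q} → Walk Overlap W₁ Ws Q → Overlap Q W₁ → Valid K m W₁ →
                Distinct (map tail (W₁ ∷ Ws)) → (∀ {x} → x ∈ map tail (W₁ ∷ Ws) → x ∈ Vs) →
                (∀ {x} → x ∈ Vs → x ∈ map tail (W₁ ∷ Ws)) → ClassCycle K m (suc k)
  class-cycle {W₁} {Ws} walk closing vW₁ distinct ⊆Vs covers = length Ws , size , cycle , one-per-class
    where
    LW = W₁ ∷ Ws
    size : suc (length Ws) * m ≡ numVertices K m (suc (suc k))
    size = trans (cong (_* m) (trans (sym (length-map tail LW)) (distinct-length distinct Vs-distinct ⊆Vs covers)))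
                 (sym (numVertices-step K m k))
    cycle : DirectedCycle K m (suc (suc k)) (length Ws)
    cycle = record
      { vtx = lookup LW
      ; isVertex = walk-valid walk vW₁
      ; distinct = λ i j e → lookup-injective tail LW distinct i j (cong tail e)
      ; step = λ i → overlap-edge (walk-step walk i)
      ; close = overlap-edge (subst (λ X → Overlap X W₁) (sym (walk-last walk)) closing) }
    -- The class of v is determined by tail v, a vertex of G_{k+1}, which
    -- occurs at exactly one position of the cycle.
    one-per-class : ∀ (v : V⁺) → Valid K m v →
                    Σ (Fin (suc (length Ws))) λ i → Similar (lookup LW i) v × (∀ j → Similar (lookup LW j) v → j ≡ i)
    one-per-class v vv with ∈-map⁻ tail (covers (∈Vs (valid-tail K m vv)))
    ... | W , W∈ , eqW = i , sym tail-i , λ j e → lookup-injective tail LW distinct j i (trans e tail-i)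
      where
      i = index W∈
      tail-i : tail v ≡ tail (lookup LW i)
      tail-i = trans eqW (cong tail (lookup-index W∈))

  from-hamiltonian : HamiltonianCycle _≟S_ Vs E → ∀ {v} → v ∈ Vs → ClassCycle K m (suc k)
  from-hamiltonian h vV with HamiltonianCycle.H h | HamiltonianCycle.walk h | HamiltonianCycle.distinct h
                          | HamiltonianCycle.⊆Vs h | HamiltonianCycle.covers h
  ... | [] | _ | _ | _ | covers with covers vV
  ... | ()
  from-hamiltonian h vV | h₁ ∷ H' | (W₁ , vW₁ , iW₁ , tW₁) ∷ w | distinct | ⊆Vs | covers with lift-walk W₁ tW₁ vW₁ w
  ... | Q , Ws , walk , tQ , vQ , tails =
    class-cycle walk (trans tQ (sym iW₁) , vQ , vW₁) vW₁ (subst Distinct (sym tails⁺) distinct)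
      (λ {x} p → ⊆Vs (subst (x ∈_) tails⁺ p)) (λ {x} p → subst (x ∈_) (sym tails⁺) (covers p))
    where
    tails⁺ : map tail (W₁ ∷ Ws) ≡ h₁ ∷ H'
    tails⁺ = cong₂ _∷_ tW₁ tails

lemma5p3 : (K : Kind) (m n : ℕ) → 1 ≤ m → 1 ≤ n →
    Σ ℕ λ c' → (suc c' * m ≡ numVertices K m (suc n)) ×
    Σ (DirectedCycle K m (suc n) c') λ C →
    ∀ (v : Str (alphabet K m) (suc n)) → IsVertex K m (suc n) v →
    Σ (Fin (suc c')) λ i → Similar (DirectedCycle.vtx C i) v ×
    (∀ j → Similar (DirectedCycle.vtx C j) v → j ≡ i)
lemma5p3 deBruijn (suc m') (suc k) _ _ =
  LineGraph.from-hamiltonian deBruijn (suc m') k (DeBruijn.hamiltonian-cycle m' k)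
    (Graph.∈Vs deBruijn (suc m') k {replicate _ zero} tt)
lemma5p3 kautz (suc m') (suc zero) _ _ =
  LineGraph.from-hamiltonian kautz (suc m') zero (KautzSingle.hamiltonian-cycle m')
    (Graph.∈Vs kautz (suc m') zero (kz-one zero))
lemma5p3 kautz (suc m') (suc (suc k)) _ _ =
  LineGraph.from-hamiltonian kautz (suc m') (suc k) (Kautz.hamiltonian-cycle m' k)
    (Graph.∈Vs kautz (suc m') (suc k) (Kautz.alternating-kautz m' k (suc (suc k)) zero))
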